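{- Let $(f,g,d,h,m)$ be an NCS system over a unital associative $K$-algebra $A$, with coefficients $f(t)=\sum_{m\ge0}t^m\lambda_m$, $g(t)=\sum_{m\ge0}t^ms_m$, $d(t)=\sum_{m\ge1}\frac{t^m}{m}\phi_m$, $h(t)=\sum_{m\ge1}t^{m-1}\psi_m$, $m(t)=\sum_{m\ge1}t^{m-1}\xi_m$. Let $\tau:A\to A$ be a unit-preserving $K$-algebra homomorphism with $\tau(\phi_m)=-\phi_m$ for all $m\ge1$. Then for all $m\ge 1$: $\tau(\lambda_m)=(-1)^ms_m$, $\tau(s_m)=(-1)^m\lambda_m$, $\tau(\psi_m)=-\xi_m$, $\tau(\xi_m)=-\psi_m$.
   Context: $K$ is a unital commutative $\mathbb{Q}$-algebra; $t$ is a formal central parameter. An NCS system over $A$ is a $5$-tuple $(f(t),g(t),d(t),h(t),m(t))\in A[[t]]^{\times5}$ with $d(0)=0$ satisfying $f(0)=1$; $f(-t)g(t)=g(t)f(-t)=1$; $e^{d(t)}=g(t)$ (with $e^{d(t)}=\sum_{k\ge0}d(t)^k/k!$); $g'(t)=g(t)h(t)$; $g'(t)=m(t)g(t)$, where $'$ denotes $d/dt$. -}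

module Defs where

open import Level using (Level; _⊔_) renaming (suc to lsuc)
open import Function using (_∘_)
open import Data.Nat as ℕ using (ℕ; zero; suc; _∸_; _!)
open import Data.Nat.Properties using (_!≢0)
open import Data.Integer using (+_)
open import Data.Rational as ℚ using (ℚ)
open import Data.Rational.Properties using (+-*-commutativeRing)
open import Algebra.Bundles using (Ring; CommutativeRing)
open import Algebra.Morphism.Structures using (IsRingHomomorphism)

record QAlgebra (c ℓ : Level) : Set (lsuc (c ⊔ ℓ)) where
  field
    commRing : CommutativeRing c ℓ
  open CommutativeRing commRing public
  field
    fromℚ   : ℚ → Carrier
    fromℚ-hom : IsRingHomomorphism (CommutativeRing.rawRing +-*-commutativeRing) rawRing fromℚ

record KAlgebra {c₁ ℓ₁} (K : QAlgebra c₁ ℓ₁) (c ℓ : Level) : Set (c₁ ⊔ ℓ₁ ⊔ lsuc (c ⊔ ℓ)) where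
  field
    algRing : Ring c ℓ
  open Ring algRing public
  field
    ι       : QAlgebra.Carrier K → Carrier
    ι-hom   : IsRingHomomorphism (QAlgebra.rawRing K) rawRing ι
    ι-central : ∀ k a → ι k * a ≈ a * ι k

  fromℚ : ℚ → Carrier
  fromℚ = ι ∘ QAlgebra.fromℚ K

record IsKAlgebraEndo {c₁ ℓ₁ c ℓ} {K : QAlgebra c₁ ℓ₁} (A : KAlgebra K c ℓ)
       (τ : KAlgebra.Carrier A → KAlgebra.Carrier A) : Set (c₁ ⊔ c ⊔ ℓ) where
  open KAlgebra A
  field
    ring-hom : IsRingHomomorphism rawRing rawRing τ
    K-linear : ∀ k a → τ (ι k * a) ≈ ι k * τ a

-- Formal power series A[[t]] in a central variable t, as coefficient sequences.
module PowerSeries {c₁ ℓ₁ c ℓ} {K : QAlgebra c₁ ℓ₁} (A : KAlgebra K c ℓ) where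
  open KAlgebra A hiding (zero)
  open import Algebra.Definitions.RawMonoid +-rawMonoid using () renaming (_×_ to _·ℕ_)

  PS : Set c
  PS = ℕ → Carrier

  _≈ₚ_ : PS → PS → Set ℓ
  f ≈ₚ g = ∀ n → f n ≈ g n

  sumTo : (ℕ → Carrier) → ℕ → Carrier
  sumTo a zero    = a zero
  sumTo a (suc n) = sumTo a n + a (suc n)

  _⊛_ : PS → PS → PS
  (f ⊛ g) n = sumTo (λ i → f i * g (n ∸ i)) n

  oneₚ : PS
  oneₚ zero    = 1#
  oneₚ (suc n) = 0#

  _^ₚ_ : PS → ℕ → PS
  f ^ₚ zero  = oneₚ
  f ^ₚ suc k = f ⊛ (f ^ₚ k)

  sign : ℕ → Carrier
  sign zero    = 1#
  sign (suc n) = - sign n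

  neg-t : PS → PS
  neg-t f n = sign n * f n

  deriv : PS → PS
  deriv f n = suc n ·ℕ f (suc n)

  -- e^{d(t)} = Σ_k d(t)^k / k!, for d(0) = 0.  Since d(t)^k has no
  -- coefficients below t^k, the t^n coefficient is the finite sum over k ≤ n.
  expₚ : PS → PS
  expₚ d n = sumTo (λ k → fromℚ (((+ 1) ℚ./ (k !)) {{k !≢0}}) * (d ^ₚ k) n) n

  record IsNCS (f g d h m : PS) : Set ℓ where
    field
      d0   : d 0 ≈ 0#
      f0   : f 0 ≈ 1#
      fg   : (neg-t f ⊛ g) ≈ₚ oneₚ
      gf   : (g ⊛ neg-t f) ≈ₚ oneₚ
      expd : expₚ d ≈ₚ g
      g'h  : deriv g ≈ₚ (g ⊛ h)
      g'm  : deriv g ≈ₚ (m ⊛ g)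

  λ-coeff : PS → ℕ → Carrier
  λ-coeff f n = f n

  s-coeff : PS → ℕ → Carrier
  s-coeff g n = g n

  -- φ_n = n · d_n  (so that d_n = φ_n / n)
  φ-coeff : PS → ℕ → Carrier
  φ-coeff d n = n ·ℕ d n

  -- ψ_n = h_{n-1},  ξ_n = m_{n-1}  (used for n ≥ 1)
  ψ-coeff : PS → ℕ → Carrier
  ψ-coeff h n = h (n ∸ 1)

  ξ-coeff : PS → ℕ → Carrier
  ξ-coeff m n = m (n ∸ 1)

-- Let F := neg-t f, the series f(-t), so that F ⊛ g = g ⊛ F = 1.  Applying τ coefficientwise is
-- a ring endomorphism of A[[t]] commuting with d/dt and with e^(-), and τ(d) = -d because
-- τ(n d_n) = -n d_n and n is invertible.  Substituting d (with d(0) = 0) into power series is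
-- multiplicative, so e^(-t) e^t = 1 (its derivative vanishes) gives e^(-d) ⊛ e^d = 1.  Hence
-- τ(g) = e^(-d) is the inverse F of g, and applying τ to F ⊛ g = 1 gives τ(F) = g.  Finally
-- h = F ⊛ g' and m = g' ⊛ F, while differentiating g ⊛ F = 1 and F ⊛ g = 1 gives
-- g ⊛ F' = -(g' ⊛ F) and F' ⊛ g = -(F ⊛ g'), that is, τ(h) = -m and τ(m) = -h.
module Submission where

open import Defs
open import Level using (Level; _⊔_)
open import Data.Nat as ℕ using (ℕ; _≤_; zero; suc; _<_; _∸_; z≤n; s≤s; _!; NonZero)
open import Data.Product using (_×_; _,_)
import Data.Nat.Properties as ℕₚ
open import Data.Nat.Properties using (_!≢0)
open import Data.Sum using (inj₁; inj₂)
open import Data.Integer as ℤ using (+_)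
import Data.Integer.Properties as ℤₚ
open import Data.Rational as ℚ using (_/_; 1ℚ)
open import Data.Rational.Properties
  using (toℚᵘ-injective; toℚᵘ-fromℚᵘ; toℚᵘ-homo-+; toℚᵘ-homo-*; +-*-commutativeRing)
open import Data.Rational.Unnormalised.Base as ℚᵘ using (mkℚᵘ; *≡*)
import Data.Rational.Unnormalised.Properties as ℚᵘₚ
open import Algebra.Bundles using (CommutativeRing)
open import Algebra.Morphism.Structures using (IsRingHomomorphism)
import Algebra.Morphism.Construct.Composition as Composition
open import Relation.Binary.PropositionalEquality as ≡ using (_≡_)

[1+m]/1≡1+[m/1] : ∀ m → + suc m / 1 ≡ 1ℚ ℚ.+ + m / 1
[1+m]/1≡1+[m/1] m = toℚᵘ-injective (ℚᵘₚ.≃-trans (toℚᵘ-fromℚᵘ (mkℚᵘ (+ suc m) 0))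
  (ℚᵘₚ.≃-sym (ℚᵘₚ.≃-trans (toℚᵘ-homo-+ 1ℚ (+ m / 1))
    (ℚᵘₚ.≃-trans (ℚᵘₚ.+-congʳ (ℚ.toℚᵘ 1ℚ) (toℚᵘ-fromℚᵘ (mkℚᵘ (+ m) 0)))
      (*≡* (≡.cong (λ x → (+ 1 ℤ.+ x) ℤ.* + 1) (ℤₚ.*-identityʳ (+ m))))))))

[1+k]/1*1/[1+k]≡1 : ∀ k → (+ suc k / 1) ℚ.* (+ 1 / suc k) ≡ 1ℚ
[1+k]/1*1/[1+k]≡1 k = toℚᵘ-injective (ℚᵘₚ.≃-trans (toℚᵘ-homo-* (+ suc k / 1) (+ 1 / suc k))
  (ℚᵘₚ.≃-trans (ℚᵘₚ.*-cong (toℚᵘ-fromℚᵘ (mkℚᵘ (+ suc k) 0)) (toℚᵘ-fromℚᵘ (mkℚᵘ (+ 1) k)))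
    (ℚᵘₚ.*-inverseʳ (mkℚᵘ (+ suc k) 0))))

module _ {c₁ ℓ₁ c ℓ : Level} {K : QAlgebra c₁ ℓ₁} (A : KAlgebra K c ℓ) where
  open KAlgebra A hiding (zero)
  open PowerSeries A
  open import Algebra.Properties.Ring algRing
  open import Algebra.Properties.Semiring.Mult semiring
  open import Algebra.Properties.CommutativeMonoid.Mult +-commutativeMonoid using (×-distrib-+)
  open import Algebra.Definitions.RawMonoid +-rawMonoid using () renaming (_×_ to _·ℕ_)
  open import Relation.Binary.Reasoning.Setoid setoid

  Σ≤ : ℕ → (ℕ → Carrier) → Carrier
  Σ≤ n a = sumTo a n

  infix 5 Σ≤
  syntax Σ≤ n (λ i → e) = Σ[ i ≤ n ] e

  sumTo-cong≤ : ∀ {a b : ℕ → Carrier} n → (∀ i → i ≤ n → a i ≈ b i) → sumTo a n ≈ sumTo b n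
  sumTo-cong≤ zero    a≈b = a≈b 0 z≤n
  sumTo-cong≤ (suc n) a≈b =
    +-cong (sumTo-cong≤ n (λ i i≤n → a≈b i (ℕₚ.m≤n⇒m≤1+n i≤n))) (a≈b (suc n) ℕₚ.≤-refl)

  sumTo-cong : ∀ {a b : ℕ → Carrier} n → (∀ i → a i ≈ b i) → sumTo a n ≈ sumTo b n
  sumTo-cong n a≈b = sumTo-cong≤ n (λ i _ → a≈b i)

  sumTo-homo : (φ : Carrier → Carrier) → (∀ x y → φ (x + y) ≈ φ x + φ y) →
               ∀ a n → φ (sumTo a n) ≈ Σ[ i ≤ n ] φ (a i)
  sumTo-homo φ φ-+ a zero    = refl
  sumTo-homo φ φ-+ a (suc n) = trans (φ-+ _ _) (+-congʳ (sumTo-homo φ φ-+ a n))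

  *-distribˡ-sumTo : ∀ x a n → x * sumTo a n ≈ Σ[ i ≤ n ] x * a i
  *-distribˡ-sumTo x = sumTo-homo (x *_) (distribˡ x)

  *-distribʳ-sumTo : ∀ x a n → sumTo a n * x ≈ Σ[ i ≤ n ] a i * x
  *-distribʳ-sumTo x = sumTo-homo (_* x) (distribʳ x)

  -‿sumTo : ∀ a n → - sumTo a n ≈ Σ[ i ≤ n ] - a i
  -‿sumTo = sumTo-homo -_ (λ x y → sym (-‿+-comm x y))

  ×-sumTo : ∀ m a n → m ·ℕ sumTo a n ≈ Σ[ i ≤ n ] m ·ℕ a i
  ×-sumTo m = sumTo-homo (m ·ℕ_) (λ x y → ×-distrib-+ x y m)

  sumTo-*-sumTo : ∀ a b m n → sumTo a m * sumTo b n ≈ Σ[ i ≤ m ] Σ[ j ≤ n ] a i * b j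
  sumTo-*-sumTo a b m n = trans (*-distribʳ-sumTo _ a m) (sumTo-cong m (λ i → *-distribˡ-sumTo (a i) b n))

  sumTo-+ : ∀ a b n → Σ[ i ≤ n ] (a i + b i) ≈ sumTo a n + sumTo b n
  sumTo-+ a b zero    = refl
  sumTo-+ a b (suc n) = begin
    (Σ[ i ≤ n ] (a i + b i)) + (a (suc n) + b (suc n))  ≈⟨ +-congʳ (sumTo-+ a b n) ⟩
    (sumTo a n + sumTo b n) + (a (suc n) + b (suc n))   ≈⟨ +-assoc _ _ _ ⟩
    sumTo a n + (sumTo b n + (a (suc n) + b (suc n)))   ≈⟨ +-congˡ (+-assoc _ _ _) ⟨
    sumTo a n + ((sumTo b n + a (suc n)) + b (suc n))   ≈⟨ +-congˡ (+-congʳ (+-comm _ _)) ⟩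
    sumTo a n + ((a (suc n) + sumTo b n) + b (suc n))   ≈⟨ +-congˡ (+-assoc _ _ _) ⟩
    sumTo a n + (a (suc n) + (sumTo b n + b (suc n)))   ≈⟨ +-assoc _ _ _ ⟨
    (sumTo a n + a (suc n)) + (sumTo b n + b (suc n))   ∎

  sumTo-zero : ∀ a n → (∀ i → i ≤ n → a i ≈ 0#) → sumTo a n ≈ 0#
  sumTo-zero a zero    a≈0 = a≈0 0 z≤n
  sumTo-zero a (suc n) a≈0 = trans
    (+-cong (sumTo-zero a n (λ i i≤n → a≈0 i (ℕₚ.m≤n⇒m≤1+n i≤n))) (a≈0 (suc n) ℕₚ.≤-refl))
    (+-identityˡ 0#)

  sumTo-head : ∀ a n → (∀ i → a (suc i) ≈ 0#) → sumTo a n ≈ a 0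
  sumTo-head a zero    a≈0 = refl
  sumTo-head a (suc n) a≈0 = trans (+-cong (sumTo-head a n a≈0) (a≈0 n)) (+-identityʳ _)

  sumTo-last : ∀ a n → (∀ i → i < n → a i ≈ 0#) → sumTo a n ≈ a n
  sumTo-last a zero    a≈0 = refl
  sumTo-last a (suc n) a≈0 = trans (+-congʳ (sumTo-zero a n (λ i i≤n → a≈0 i (s≤s i≤n)))) (+-identityˡ _)

  sumTo-suc : ∀ a n → sumTo a (suc n) ≈ a 0 + (Σ[ i ≤ n ] a (suc i))
  sumTo-suc a zero    = refl
  sumTo-suc a (suc n) = trans (+-congʳ (sumTo-suc a n)) (+-assoc _ _ _)

  sumTo-swap : ∀ (F : ℕ → ℕ → Carrier) m n →
               Σ[ i ≤ m ] Σ[ j ≤ n ] F i j ≈ Σ[ j ≤ n ] Σ[ i ≤ m ] F i j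
  sumTo-swap F zero    n = refl
  sumTo-swap F (suc m) n = trans (+-congʳ (sumTo-swap F m n)) (sym (sumTo-+ _ (F (suc m)) n))

  sumTo-extend : ∀ a {m n} → m ≤ n → (∀ i → m < i → i ≤ n → a i ≈ 0#) → sumTo a m ≈ sumTo a n
  sumTo-extend a {n = zero}  z≤n   a≈0 = refl
  sumTo-extend a {n = suc n} m≤1+n a≈0 with ℕₚ.m≤n⇒m<n∨m≡n m≤1+n
  ... | inj₁ (s≤s m≤n) = trans (sym (+-identityʳ _)) (+-cong
          (sumTo-extend a m≤n (λ i m<i i≤n → a≈0 i m<i (ℕₚ.m≤n⇒m≤1+n i≤n)))
          (sym (a≈0 (suc n) (s≤s m≤n) ℕₚ.≤-refl)))
  ... | inj₂ ≡.refl = refl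

  sumTo-triangle : ∀ (F : ℕ → ℕ → Carrier) n →
                   Σ[ i ≤ n ] Σ[ j ≤ n ∸ i ] F i j ≈ Σ[ k ≤ n ] Σ[ i ≤ k ] F i (k ∸ i)
  sumTo-triangle F zero    = refl
  sumTo-triangle F (suc n) = begin
    (Σ[ i ≤ n ] Σ[ j ≤ suc n ∸ i ] F i j) + (Σ[ j ≤ n ∸ n ] F (suc n) j)
      ≈⟨ +-cong (sumTo-cong≤ n peel) (reflexive (≡.cong (sumTo (F (suc n))) (ℕₚ.n∸n≡0 n))) ⟩
    (Σ[ i ≤ n ] ((Σ[ j ≤ n ∸ i ] F i j) + F i (suc n ∸ i))) + F (suc n) 0
      ≈⟨ +-congʳ (sumTo-+ _ _ n) ⟩
    ((Σ[ i ≤ n ] Σ[ j ≤ n ∸ i ] F i j) + (Σ[ i ≤ n ] F i (suc n ∸ i))) + F (suc n) 0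
      ≈⟨ +-assoc _ _ _ ⟩
    (Σ[ i ≤ n ] Σ[ j ≤ n ∸ i ] F i j) + ((Σ[ i ≤ n ] F i (suc n ∸ i)) + F (suc n) 0)
      ≈⟨ +-cong (sumTo-triangle F n) (+-congˡ (reflexive (≡.cong (F (suc n)) (≡.sym (ℕₚ.n∸n≡0 n))))) ⟩
    (Σ[ k ≤ n ] Σ[ i ≤ k ] F i (k ∸ i)) + (Σ[ i ≤ suc n ] F i (suc n ∸ i)) ∎
    where
    peel : ∀ i → i ≤ n → Σ[ j ≤ suc n ∸ i ] F i j ≈ (Σ[ j ≤ n ∸ i ] F i j) + F i (suc n ∸ i)
    peel i i≤n rewrite ℕₚ.+-∸-assoc 1 i≤n = refl

  Central : Carrier → Set (c ⊔ ℓ)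
  Central x = ∀ y → x * y ≈ y * x

  *-interchange-central : ∀ {b} → Central b → ∀ a x y → (a * x) * (b * y) ≈ (a * b) * (x * y)
  *-interchange-central {b} b-central a x y = begin
    (a * x) * (b * y)  ≈⟨ *-assoc a x _ ⟩
    a * (x * (b * y))  ≈⟨ *-congˡ (*-assoc x b y) ⟨
    a * ((x * b) * y)  ≈⟨ *-congˡ (*-congʳ (b-central x)) ⟨
    a * ((b * x) * y)  ≈⟨ *-congˡ (*-assoc b x y) ⟩
    a * (b * (x * y))  ≈⟨ *-assoc a b _ ⟨
    (a * b) * (x * y)  ∎

  sign-central : ∀ n → Central (sign n)
  sign-central zero    x = trans (*-identityˡ x) (sym (*-identityʳ x))
  sign-central (suc n) x = begin
    - sign n * x    ≈⟨ -‿distribˡ-* _ x ⟨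
    - (sign n * x)  ≈⟨ -‿cong (sign-central n x) ⟩
    - (x * sign n)  ≈⟨ -‿distribʳ-* x _ ⟩
    x * - sign n    ∎

  sign-involutive : ∀ n x → sign n * (sign n * x) ≈ x
  sign-involutive zero    x = trans (*-identityˡ _) (*-identityˡ x)
  sign-involutive (suc n) x = begin
    - s * (- s * x)    ≈⟨ -‿distribˡ-* s _ ⟨
    - (s * (- s * x))  ≈⟨ -‿cong (*-congˡ (-‿distribˡ-* s x)) ⟨
    - (s * - (s * x))  ≈⟨ -‿cong (-‿distribʳ-* s _) ⟨
    - - (s * (s * x))  ≈⟨ -‿involutive _ ⟩
    s * (s * x)        ≈⟨ sign-involutive n x ⟩
    x                  ∎
    where s = sign n

  ≈ₚ-refl : ∀ {f} → f ≈ₚ f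
  ≈ₚ-refl _ = refl

  negₚ : PS → PS
  negₚ f n = - f n

  ⊛-cong : ∀ {f f′ g g′} → f ≈ₚ f′ → g ≈ₚ g′ → (f ⊛ g) ≈ₚ (f′ ⊛ g′)
  ⊛-cong f≈f′ g≈g′ n = sumTo-cong n (λ i → *-cong (f≈f′ i) (g≈g′ (n ∸ i)))

  ⊛-congˡ : ∀ {f g g′} → g ≈ₚ g′ → (f ⊛ g) ≈ₚ (f ⊛ g′)
  ⊛-congˡ {f} = ⊛-cong {f} {f} ≈ₚ-refl

  ⊛-congʳ : ∀ {f f′ g} → f ≈ₚ f′ → (f ⊛ g) ≈ₚ (f′ ⊛ g)
  ⊛-congʳ {g = g} f≈f′ = ⊛-cong {g = g} {g} f≈f′ ≈ₚ-refl

  ⊛-assoc : ∀ f g h → ((f ⊛ g) ⊛ h) ≈ₚ (f ⊛ (g ⊛ h))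
  ⊛-assoc f g h n = begin
    Σ[ k ≤ n ] (f ⊛ g) k * h (n ∸ k)
      ≈⟨ sumTo-cong≤ n (λ k k≤n → trans (*-distribʳ-sumTo _ _ k)
           (sumTo-cong≤ k (λ i i≤k → *-congˡ (reflexive (≡.cong h (∸-split i≤k)))))) ⟩
    Σ[ k ≤ n ] Σ[ i ≤ k ] F i (k ∸ i)
      ≈⟨ sumTo-triangle F n ⟨
    Σ[ i ≤ n ] Σ[ j ≤ n ∸ i ] F i j
      ≈⟨ sumTo-cong n (λ i → trans (sumTo-cong (n ∸ i) (λ j → *-assoc _ _ _))
           (sym (*-distribˡ-sumTo _ _ (n ∸ i)))) ⟩
    (f ⊛ (g ⊛ h)) n ∎
    where
    F : ℕ → ℕ → Carrier
    F i j = (f i * g j) * h (n ∸ i ∸ j)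
    ∸-split : ∀ {i k} → i ≤ k → n ∸ k ≡ n ∸ i ∸ (k ∸ i)
    ∸-split {i} {k} i≤k =
      ≡.trans (≡.cong (n ∸_) (≡.sym (ℕₚ.m+[n∸m]≡n i≤k))) (≡.sym (ℕₚ.∸-+-assoc n i (k ∸ i)))

  ⊛-identityˡ : ∀ f → (oneₚ ⊛ f) ≈ₚ f
  ⊛-identityˡ f n = trans (sumTo-head _ n (λ i → zeroˡ _)) (*-identityˡ _)

  ⊛-identityʳ : ∀ f → (f ⊛ oneₚ) ≈ₚ f
  ⊛-identityʳ f n = begin
    (f ⊛ oneₚ) n              ≈⟨ sumTo-last _ n (λ i i<n → trans (*-congˡ (oneₚ-pos i<n)) (zeroʳ _)) ⟩
    f n * oneₚ (n ∸ n)        ≈⟨ *-congˡ (reflexive (≡.cong oneₚ (ℕₚ.n∸n≡0 n))) ⟩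
    f n * 1#                  ≈⟨ *-identityʳ _ ⟩
    f n ∎
    where
    oneₚ-pos : ∀ {i} → i < n → oneₚ (n ∸ i) ≈ 0#
    oneₚ-pos {i} i<n with n ∸ i | ℕₚ.m<n⇒0<n∸m i<n
    ... | suc _ | _ = refl

  negₚ-⊛ : ∀ f g → (negₚ f ⊛ g) ≈ₚ negₚ (f ⊛ g)
  negₚ-⊛ f g n = trans (sumTo-cong n (λ i → sym (-‿distribˡ-* _ _))) (sym (-‿sumTo _ n))

  ⊛-inverse-unique : ∀ {x y z} → (x ⊛ y) ≈ₚ oneₚ → (y ⊛ z) ≈ₚ oneₚ → x ≈ₚ z
  ⊛-inverse-unique {x} {y} {z} xy≈1 yz≈1 n = begin
    x n                ≈⟨ ⊛-identityʳ x n ⟨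
    (x ⊛ oneₚ) n       ≈⟨ ⊛-congˡ {x} yz≈1 n ⟨
    (x ⊛ (y ⊛ z)) n    ≈⟨ ⊛-assoc x y z n ⟨
    ((x ⊛ y) ⊛ z) n    ≈⟨ ⊛-congʳ {g = z} xy≈1 n ⟩
    (oneₚ ⊛ z) n       ≈⟨ ⊛-identityˡ z n ⟩
    z n                ∎

  ×-zeroʳ : ∀ n → n ·ℕ 0# ≈ 0#
  ×-zeroʳ zero    = refl
  ×-zeroʳ (suc n) = trans (+-identityˡ _) (×-zeroʳ n)

  ×-homo-neg : ∀ n x → n ·ℕ (- x) ≈ - (n ·ℕ x)
  ×-homo-neg zero    x = sym -0#≈0#
  ×-homo-neg (suc n) x = trans (+-congˡ (×-homo-neg n x)) (-‿+-comm x (n ·ℕ x))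

  deriv-cong : ∀ {f f′} → f ≈ₚ f′ → deriv f ≈ₚ deriv f′
  deriv-cong f≈f′ n = ×-congʳ (suc n) (f≈f′ (suc n))

  deriv-oneₚ : ∀ n → deriv oneₚ n ≈ 0#
  deriv-oneₚ n = ×-zeroʳ (suc n)

  deriv-neg-t : ∀ f → deriv (neg-t f) ≈ₚ negₚ (neg-t (deriv f))
  deriv-neg-t f n = begin
    suc n ·ℕ (- sign n * f (suc n))    ≈⟨ ×-congʳ (suc n) (-‿distribˡ-* _ _) ⟨
    suc n ·ℕ (- (sign n * f (suc n)))  ≈⟨ ×-homo-neg (suc n) _ ⟩
    - (suc n ·ℕ (sign n * f (suc n)))  ≈⟨ -‿cong (×-comm-* (suc n) _ _) ⟨
    - (sign n * deriv f n)             ∎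

  deriv-⊛ : ∀ f g n → deriv (f ⊛ g) n ≈ (deriv f ⊛ g) n + (f ⊛ deriv g) n
  deriv-⊛ f g n = begin
    suc n ·ℕ sumTo T (suc n)
      ≈⟨ ×-sumTo (suc n) T (suc n) ⟩
    Σ[ i ≤ suc n ] suc n ·ℕ T i
      ≈⟨ sumTo-cong≤ (suc n) split ⟩
    Σ[ i ≤ suc n ] (i ·ℕ T i + (suc n ∸ i) ·ℕ T i)
      ≈⟨ sumTo-+ _ _ (suc n) ⟩
    (Σ[ i ≤ suc n ] i ·ℕ T i) + (Σ[ i ≤ suc n ] (suc n ∸ i) ·ℕ T i)
      ≈⟨ +-cong differentiate-f differentiate-g ⟩
    (deriv f ⊛ g) n + (f ⊛ deriv g) n ∎
    where
    T : ℕ → Carrier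
    T i = f i * g (suc n ∸ i)
    split : ∀ i → i ≤ suc n → suc n ·ℕ T i ≈ i ·ℕ T i + (suc n ∸ i) ·ℕ T i
    split i i≤1+n = trans (×-congˡ (≡.sym (ℕₚ.m+[n∸m]≡n i≤1+n))) (×-homo-+ (T i) i (suc n ∸ i))
    differentiate-f : Σ[ i ≤ suc n ] i ·ℕ T i ≈ (deriv f ⊛ g) n
    differentiate-f = trans (sumTo-suc _ n)
      (trans (+-identityˡ _) (sumTo-cong n (λ i → sym (×-assoc-* (suc i) _ _))))
    shift : ∀ i → i ≤ n → (suc n ∸ i) ·ℕ T i ≈ f i * deriv g (n ∸ i)
    shift i i≤n rewrite ℕₚ.+-∸-assoc 1 i≤n = sym (×-comm-* (suc (n ∸ i)) (f i) _)
    differentiate-g : Σ[ i ≤ suc n ] (suc n ∸ i) ·ℕ T i ≈ (f ⊛ deriv g) n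
    differentiate-g = trans (+-cong (sumTo-cong≤ n shift) (×-congˡ (ℕₚ.n∸n≡0 n))) (+-identityʳ _)

  deriv-⊛-inverse : ∀ {x y} → (x ⊛ y) ≈ₚ oneₚ → ∀ n → (deriv x ⊛ y) n + (x ⊛ deriv y) n ≈ 0#
  deriv-⊛-inverse {x} {y} xy≈1 n =
    trans (sym (deriv-⊛ x y n)) (trans (deriv-cong xy≈1 n) (deriv-oneₚ n))

  fromℚ-hom : IsRingHomomorphism (CommutativeRing.rawRing +-*-commutativeRing) rawRing fromℚ
  fromℚ-hom = Composition.isRingHomomorphism trans (QAlgebra.fromℚ-hom K) ι-hom

  module ℚ→A = IsRingHomomorphism fromℚ-hom

  ×1≈fromℚ : ∀ m → m ·ℕ 1# ≈ fromℚ (+ m / 1)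
  ×1≈fromℚ zero    = sym ℚ→A.0#-homo
  ×1≈fromℚ (suc m) = begin
    1# + m ·ℕ 1#                ≈⟨ +-cong (sym ℚ→A.1#-homo) (×1≈fromℚ m) ⟩
    fromℚ 1ℚ + fromℚ (+ m / 1)  ≈⟨ ℚ→A.+-homo _ _ ⟨
    fromℚ (1ℚ ℚ.+ + m / 1)      ≡⟨ ≡.cong fromℚ ([1+m]/1≡1+[m/1] m) ⟨
    fromℚ (+ suc m / 1)         ∎

  ×-fromℚ-inverse : ∀ m .{{_ : NonZero m}} → m ·ℕ fromℚ (+ 1 / m) ≈ 1#
  ×-fromℚ-inverse m@(suc k) = begin
    m ·ℕ fromℚ (+ 1 / m)               ≈⟨ ×-congʳ m (*-identityˡ _) ⟨
    m ·ℕ (1# * fromℚ (+ 1 / m))        ≈⟨ ×-assoc-* m 1# _ ⟨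
    (m ·ℕ 1#) * fromℚ (+ 1 / m)        ≈⟨ *-congʳ (×1≈fromℚ m) ⟩
    fromℚ (+ m / 1) * fromℚ (+ 1 / m)  ≈⟨ ℚ→A.*-homo _ _ ⟨
    fromℚ ((+ m / 1) ℚ.* (+ 1 / m))    ≡⟨ ≡.cong fromℚ ([1+k]/1*1/[1+k]≡1 k) ⟩
    fromℚ 1ℚ                          ≈⟨ ℚ→A.1#-homo ⟩
    1#                                ∎

  ×-cancel : ∀ m .{{_ : NonZero m}} {x y} → m ·ℕ x ≈ m ·ℕ y → x ≈ y
  ×-cancel m {x} {y} mx≈my = begin
    x                          ≈⟨ recover x ⟨
    fromℚ (+ 1 / m) * m ·ℕ x   ≈⟨ *-congˡ mx≈my ⟩
    fromℚ (+ 1 / m) * m ·ℕ y   ≈⟨ recover y ⟩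
    y                          ∎
    where
    recover : ∀ z → fromℚ (+ 1 / m) * m ·ℕ z ≈ z
    recover z = begin
      fromℚ (+ 1 / m) * m ·ℕ z    ≈⟨ ×-comm-* m _ z ⟩
      m ·ℕ (fromℚ (+ 1 / m) * z)  ≈⟨ ×-assoc-* m _ z ⟨
      m ·ℕ fromℚ (+ 1 / m) * z    ≈⟨ *-congʳ (×-fromℚ-inverse m) ⟩
      1# * z                      ≈⟨ *-identityˡ z ⟩
      z                           ∎

  deriv≈0⇒constant : ∀ f → (∀ n → deriv f n ≈ 0#) → ∀ n → f (suc n) ≈ 0#
  deriv≈0⇒constant f f′≈0 n = ×-cancel (suc n) (trans (f′≈0 n) (sym (×-zeroʳ (suc n))))

  expSeries : PS
  expSeries k = fromℚ ((+ 1 / (k !)) {{k !≢0}})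

  deriv-expSeries : deriv expSeries ≈ₚ expSeries
  deriv-expSeries n = ×-cancel (n !) {{n !≢0}} (begin
    (n !) ·ℕ (suc n ·ℕ expSeries (suc n))   ≈⟨ ×-assocˡ _ (n !) (suc n) ⟩
    (n ! ℕ.* suc n) ·ℕ expSeries (suc n)    ≡⟨ ≡.cong (_·ℕ expSeries (suc n)) (ℕₚ.*-comm (n !) (suc n)) ⟩
    (suc n !) ·ℕ expSeries (suc n)          ≈⟨ ×-fromℚ-inverse (suc n !) {{suc n !≢0}} ⟩
    1#                                      ≈⟨ ×-fromℚ-inverse (n !) {{n !≢0}} ⟨
    (n !) ·ℕ expSeries n                    ∎)

  neg-t-expSeries-⊛-expSeries : (neg-t expSeries ⊛ expSeries) ≈ₚ oneₚ
  neg-t-expSeries-⊛-expSeries zero    = trans (*-cong (*-identityˡ _) ℚ→A.1#-homo)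
                                               (trans (*-identityʳ _) ℚ→A.1#-homo)
  neg-t-expSeries-⊛-expSeries (suc n) = deriv≈0⇒constant (neg-t expSeries ⊛ expSeries) derivative-vanishes n
    where
    derivative-vanishes : ∀ n → deriv (neg-t expSeries ⊛ expSeries) n ≈ 0#
    derivative-vanishes n = begin
      deriv (neg-t expSeries ⊛ expSeries) n
        ≈⟨ deriv-⊛ (neg-t expSeries) expSeries n ⟩
      (deriv (neg-t expSeries) ⊛ expSeries) n + (neg-t expSeries ⊛ deriv expSeries) n
        ≈⟨ +-cong (⊛-congʳ {g = expSeries} (λ i → trans (deriv-neg-t expSeries i)
                    (-‿cong (*-congˡ (deriv-expSeries i)))) n)
                  (⊛-congˡ {neg-t expSeries} deriv-expSeries n) ⟩
      (negₚ (neg-t expSeries) ⊛ expSeries) n + (neg-t expSeries ⊛ expSeries) n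
        ≈⟨ +-congʳ (negₚ-⊛ (neg-t expSeries) expSeries n) ⟩
      - (neg-t expSeries ⊛ expSeries) n + (neg-t expSeries ⊛ expSeries) n
        ≈⟨ -‿inverseˡ _ ⟩
      0# ∎

  ^ₚ-cong : ∀ {f f′} → f ≈ₚ f′ → ∀ k → (f ^ₚ k) ≈ₚ (f′ ^ₚ k)
  ^ₚ-cong f≈f′ zero    = ≈ₚ-refl
  ^ₚ-cong f≈f′ (suc k) = ⊛-cong f≈f′ (^ₚ-cong f≈f′ k)

  ^ₚ-+ : ∀ f j k → ((f ^ₚ j) ⊛ (f ^ₚ k)) ≈ₚ (f ^ₚ (j ℕ.+ k))
  ^ₚ-+ f zero    k = ⊛-identityˡ (f ^ₚ k)
  ^ₚ-+ f (suc j) k n = trans (⊛-assoc f (f ^ₚ j) (f ^ₚ k) n) (⊛-congˡ {f} (^ₚ-+ f j k) n)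

  ^ₚ-vanish : ∀ {f} → f 0 ≈ 0# → ∀ k {i} → i < k → (f ^ₚ k) i ≈ 0#
  ^ₚ-vanish {f} f0≈0 (suc k) {i} (s≤s i≤k) = sumTo-zero _ i (term i≤k)
    where
    term : ∀ {i} → i ≤ k → ∀ j → j ≤ i → f j * (f ^ₚ k) (i ∸ j) ≈ 0#
    term _                  zero    _ = trans (*-congʳ f0≈0) (zeroˡ _)
    term {suc i} 1+i≤k (suc j) _ =
      trans (*-congˡ (^ₚ-vanish f0≈0 k (ℕₚ.≤-<-trans (ℕₚ.m∸n≤m i j) 1+i≤k))) (zeroʳ _)

  negₚ-^ₚ : ∀ f k n → (negₚ f ^ₚ k) n ≈ sign k * (f ^ₚ k) n
  negₚ-^ₚ f zero    n = sym (*-identityˡ _)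
  negₚ-^ₚ f (suc k) n = trans (sumTo-cong n term) (sym (*-distribˡ-sumTo _ _ n))
    where
    term : ∀ i → - f i * (negₚ f ^ₚ k) (n ∸ i) ≈ - sign k * (f i * (f ^ₚ k) (n ∸ i))
    term i = begin
      - f i * (negₚ f ^ₚ k) (n ∸ i)           ≈⟨ *-congˡ (negₚ-^ₚ f k (n ∸ i)) ⟩
      - f i * (sign k * (f ^ₚ k) (n ∸ i))     ≈⟨ -‿distribˡ-* _ _ ⟨
      - (f i * (sign k * (f ^ₚ k) (n ∸ i)))   ≈⟨ -‿cong (*-assoc _ _ _) ⟨
      - ((f i * sign k) * (f ^ₚ k) (n ∸ i))   ≈⟨ -‿cong (*-congʳ (sign-central k (f i))) ⟨
      - ((sign k * f i) * (f ^ₚ k) (n ∸ i))   ≈⟨ -‿cong (*-assoc _ _ _) ⟩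
      - (sign k * (f i * (f ^ₚ k) (n ∸ i)))   ≈⟨ -‿distribˡ-* _ _ ⟩
      - sign k * (f i * (f ^ₚ k) (n ∸ i))     ∎

  substₚ : PS → PS → PS
  substₚ c d n = Σ[ k ≤ n ] c k * (d ^ₚ k) n

  substₚ-congˡ : ∀ {c c′} d → c ≈ₚ c′ → substₚ c d ≈ₚ substₚ c′ d
  substₚ-congˡ d c≈c′ n = sumTo-cong n (λ k → *-congʳ (c≈c′ k))

  substₚ-congʳ : ∀ c {d d′} → d ≈ₚ d′ → substₚ c d ≈ₚ substₚ c d′
  substₚ-congʳ c d≈d′ n = sumTo-cong n (λ k → *-congˡ (^ₚ-cong d≈d′ k n))

  substₚ-extend : ∀ {d} → d 0 ≈ 0# → ∀ c {n N} → n ≤ N → substₚ c d n ≈ Σ[ k ≤ N ] c k * (d ^ₚ k) n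
  substₚ-extend d0≈0 c n≤N =
    sumTo-extend _ n≤N (λ k n<k _ → trans (*-congˡ (^ₚ-vanish d0≈0 k n<k)) (zeroʳ _))

  substₚ-oneₚ : ∀ d → substₚ oneₚ d ≈ₚ oneₚ
  substₚ-oneₚ d n = trans (sumTo-head _ n (λ _ → zeroˡ _)) (*-identityˡ _)

  substₚ-negₚ : ∀ c d → substₚ c (negₚ d) ≈ₚ substₚ (neg-t c) d
  substₚ-negₚ c d n = sumTo-cong n (λ k → begin
    c k * (negₚ d ^ₚ k) n            ≈⟨ *-congˡ (negₚ-^ₚ d k n) ⟩
    c k * (sign k * (d ^ₚ k) n)      ≈⟨ *-assoc _ _ _ ⟨
    (c k * sign k) * (d ^ₚ k) n      ≈⟨ *-congʳ (sign-central k (c k)) ⟨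
    (sign k * c k) * (d ^ₚ k) n      ∎)

  -- The coefficients c′ k must be central to be moved past those of d ^ₚ j.
  substₚ-⊛ : ∀ {d} → d 0 ≈ 0# → ∀ c c′ → (∀ k → Central (c′ k)) →
             (substₚ c d ⊛ substₚ c′ d) ≈ₚ substₚ (c ⊛ c′) d
  substₚ-⊛ {d} d0≈0 c c′ c′-central n = begin
    (substₚ c d ⊛ substₚ c′ d) n
      ≈⟨ sumTo-cong≤ n (λ i i≤n → *-cong (substₚ-extend d0≈0 c i≤n)
                                          (substₚ-extend d0≈0 c′ (ℕₚ.m∸n≤m n i))) ⟩
    Σ[ i ≤ n ] ((Σ[ j ≤ n ] c j * P j i) * (Σ[ k ≤ n ] c′ k * P k (n ∸ i)))
      ≈⟨ sumTo-cong n (λ i → sumTo-*-sumTo _ _ n n) ⟩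
    Σ[ i ≤ n ] Σ[ j ≤ n ] Σ[ k ≤ n ] (c j * P j i) * (c′ k * P k (n ∸ i))
      ≈⟨ trans (sumTo-swap _ n n) (sumTo-cong n (λ j → sumTo-swap _ n n)) ⟩
    Σ[ j ≤ n ] Σ[ k ≤ n ] Σ[ i ≤ n ] (c j * P j i) * (c′ k * P k (n ∸ i))
      ≈⟨ sumTo-cong n (λ j → sumTo-cong n (λ k → convolve j k)) ⟩
    Σ[ j ≤ n ] Σ[ k ≤ n ] (c j * c′ k) * P (j ℕ.+ k) n
      ≈⟨ sumTo-cong≤ n (λ j j≤n → sumTo-extend _ (ℕₚ.m∸n≤m n j) (λ k n∸j<k _ → beyond j k n∸j<k)) ⟨
    Σ[ j ≤ n ] Σ[ k ≤ n ∸ j ] (c j * c′ k) * P (j ℕ.+ k) n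
      ≈⟨ sumTo-triangle _ n ⟩
    Σ[ N ≤ n ] Σ[ j ≤ N ] (c j * c′ (N ∸ j)) * P (j ℕ.+ (N ∸ j)) n
      ≈⟨ sumTo-cong n (λ N → trans (sumTo-cong≤ N (λ j j≤N → *-congˡ (P-cong (ℕₚ.m+[n∸m]≡n j≤N))))
                                   (sym (*-distribʳ-sumTo _ _ N))) ⟩
    substₚ (c ⊛ c′) d n ∎
    where
    P : ℕ → PS
    P k = d ^ₚ k
    P-cong : ∀ {j k} → j ≡ k → P j n ≈ P k n
    P-cong j≡k = reflexive (≡.cong (λ k → P k n) j≡k)
    convolve : ∀ j k → Σ[ i ≤ n ] (c j * P j i) * (c′ k * P k (n ∸ i)) ≈ (c j * c′ k) * P (j ℕ.+ k) n
    convolve j k = begin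
      Σ[ i ≤ n ] (c j * P j i) * (c′ k * P k (n ∸ i))
        ≈⟨ sumTo-cong n (λ i → *-interchange-central (c′-central k) _ _ _) ⟩
      Σ[ i ≤ n ] (c j * c′ k) * (P j i * P k (n ∸ i))  ≈⟨ *-distribˡ-sumTo _ _ n ⟨
      (c j * c′ k) * (P j ⊛ P k) n                     ≈⟨ *-congˡ (^ₚ-+ d j k n) ⟩
      (c j * c′ k) * P (j ℕ.+ k) n                     ∎
    beyond : ∀ j k → n ∸ j < k → (c j * c′ k) * P (j ℕ.+ k) n ≈ 0#
    beyond j k n∸j<k = trans (*-congˡ (^ₚ-vanish d0≈0 (j ℕ.+ k)
      (ℕₚ.≤-<-trans (ℕₚ.m≤n+m∸n n j) (ℕₚ.+-monoʳ-< j n∸j<k)))) (zeroʳ _)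

  expₚ-negₚ-⊛-expₚ : ∀ {d} → d 0 ≈ 0# → (expₚ (negₚ d) ⊛ expₚ d) ≈ₚ oneₚ
  expₚ-negₚ-⊛-expₚ {d} d0≈0 n = begin
    (expₚ (negₚ d) ⊛ expₚ d) n                           ≈⟨ ⊛-congʳ {g = expₚ d} (substₚ-negₚ expSeries d) n ⟩
    (substₚ (neg-t expSeries) d ⊛ substₚ expSeries d) n  ≈⟨ substₚ-⊛ d0≈0 _ _ (λ _ → ι-central _) n ⟩
    substₚ (neg-t expSeries ⊛ expSeries) d n             ≈⟨ substₚ-congˡ d neg-t-expSeries-⊛-expSeries n ⟩
    substₚ oneₚ d n                                      ≈⟨ substₚ-oneₚ d n ⟩
    oneₚ n                                               ∎

  mapₚ : (Carrier → Carrier) → PS → PS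
  mapₚ φ f n = φ (f n)

  module _ {φ : Carrier → Carrier} (φ-hom : IsRingHomomorphism rawRing rawRing φ) where
    private module Φ = IsRingHomomorphism φ-hom

    mapₚ-⊛ : ∀ f g → mapₚ φ (f ⊛ g) ≈ₚ (mapₚ φ f ⊛ mapₚ φ g)
    mapₚ-⊛ f g n = trans (sumTo-homo φ Φ.+-homo _ n) (sumTo-cong n (λ i → Φ.*-homo _ _))

    mapₚ-oneₚ : mapₚ φ oneₚ ≈ₚ oneₚ
    mapₚ-oneₚ zero    = Φ.1#-homo
    mapₚ-oneₚ (suc n) = Φ.0#-homo

    mapₚ-^ₚ : ∀ f k → mapₚ φ (f ^ₚ k) ≈ₚ (mapₚ φ f ^ₚ k)
    mapₚ-^ₚ f zero    = mapₚ-oneₚ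
    mapₚ-^ₚ f (suc k) n = trans (mapₚ-⊛ f (f ^ₚ k) n) (⊛-congˡ {mapₚ φ f} (mapₚ-^ₚ f k) n)

    homo-× : ∀ n x → φ (n ·ℕ x) ≈ n ·ℕ φ x
    homo-× zero    x = Φ.0#-homo
    homo-× (suc n) x = trans (Φ.+-homo _ _) (+-congˡ (homo-× n x))

    mapₚ-deriv : ∀ f → mapₚ φ (deriv f) ≈ₚ deriv (mapₚ φ f)
    mapₚ-deriv f n = homo-× (suc n) (f (suc n))

    homo-sign : ∀ n → φ (sign n) ≈ sign n
    homo-sign zero    = Φ.1#-homo
    homo-sign (suc n) = trans (Φ.-‿homo _) (-‿cong (homo-sign n))

  mapₚ-expₚ : ∀ {τ} → IsKAlgebraEndo A τ → ∀ d → mapₚ τ (expₚ d) ≈ₚ expₚ (mapₚ τ d)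
  mapₚ-expₚ {τ} endo d n = trans (sumTo-homo τ +-homo _ n)
    (sumTo-cong n (λ k → trans (K-linear _ _) (*-congˡ (mapₚ-^ₚ ring-hom d k n))))
    where open IsKAlgebraEndo endo
          open IsRingHomomorphism ring-hom using (+-homo)

  module NCS {f g d h m : PS} (ncs : IsNCS f g d h m) where
    open IsNCS ncs

    h≈f[-t]⊛g′ : h ≈ₚ (neg-t f ⊛ deriv g)
    h≈f[-t]⊛g′ n = begin
      h n                          ≈⟨ ⊛-identityˡ h n ⟨
      (oneₚ ⊛ h) n                 ≈⟨ ⊛-congʳ {g = h} fg n ⟨
      ((neg-t f ⊛ g) ⊛ h) n        ≈⟨ ⊛-assoc (neg-t f) g h n ⟩
      (neg-t f ⊛ (g ⊛ h)) n        ≈⟨ ⊛-congˡ {neg-t f} g'h n ⟨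
      (neg-t f ⊛ deriv g) n        ∎

    m≈g′⊛f[-t] : m ≈ₚ (deriv g ⊛ neg-t f)
    m≈g′⊛f[-t] n = begin
      m n                          ≈⟨ ⊛-identityʳ m n ⟨
      (m ⊛ oneₚ) n                 ≈⟨ ⊛-congˡ {m} gf n ⟨
      (m ⊛ (g ⊛ neg-t f)) n        ≈⟨ ⊛-assoc m g (neg-t f) n ⟨
      ((m ⊛ g) ⊛ neg-t f) n        ≈⟨ ⊛-congʳ {g = neg-t f} g'm n ⟨
      (deriv g ⊛ neg-t f) n        ∎

    expₚ-negₚ≈f[-t] : expₚ (negₚ d) ≈ₚ neg-t f
    expₚ-negₚ≈f[-t] = ⊛-inverse-unique
      (λ n → trans (⊛-congˡ {expₚ (negₚ d)} (λ i → sym (expd i)) n) (expₚ-negₚ-⊛-expₚ d0 n)) gf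

    module Reflection {τ : Carrier → Carrier} (endo : IsKAlgebraEndo A τ)
                      (τφ≈-φ : ∀ n → 1 ≤ n → τ (φ-coeff d n) ≈ - φ-coeff d n) where
      open IsKAlgebraEndo endo using (ring-hom)
      open IsRingHomomorphism ring-hom using (⟦⟧-cong; 0#-homo; *-homo)

      τ∘d≈-d : mapₚ τ d ≈ₚ negₚ d
      τ∘d≈-d zero    = begin
        τ (d 0)   ≈⟨ ⟦⟧-cong d0 ⟩
        τ 0#      ≈⟨ 0#-homo ⟩
        0#        ≈⟨ -0#≈0# ⟨
        - 0#      ≈⟨ -‿cong d0 ⟨
        - d 0     ∎
      τ∘d≈-d (suc n) = ×-cancel (suc n) (begin
        suc n ·ℕ τ (d (suc n))   ≈⟨ homo-× ring-hom (suc n) _ ⟨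
        τ (φ-coeff d (suc n))    ≈⟨ τφ≈-φ (suc n) (s≤s z≤n) ⟩
        - φ-coeff d (suc n)      ≈⟨ ×-homo-neg (suc n) _ ⟨
        suc n ·ℕ (- d (suc n))   ∎)

      τ∘g≈f[-t] : mapₚ τ g ≈ₚ neg-t f
      τ∘g≈f[-t] n = begin
        τ (g n)              ≈⟨ ⟦⟧-cong (expd n) ⟨
        τ (expₚ d n)         ≈⟨ mapₚ-expₚ endo d n ⟩
        expₚ (mapₚ τ d) n    ≈⟨ substₚ-congʳ expSeries τ∘d≈-d n ⟩
        expₚ (negₚ d) n      ≈⟨ expₚ-negₚ≈f[-t] n ⟩
        neg-t f n            ∎

      τ∘f[-t]≈g : mapₚ τ (neg-t f) ≈ₚ g
      τ∘f[-t]≈g = ⊛-inverse-unique τF⊛F≈1 fg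
        where
        τF⊛F≈1 : (mapₚ τ (neg-t f) ⊛ neg-t f) ≈ₚ oneₚ
        τF⊛F≈1 n = begin
          (mapₚ τ (neg-t f) ⊛ neg-t f) n        ≈⟨ ⊛-congˡ {mapₚ τ (neg-t f)} τ∘g≈f[-t] n ⟨
          (mapₚ τ (neg-t f) ⊛ mapₚ τ g) n       ≈⟨ mapₚ-⊛ ring-hom (neg-t f) g n ⟨
          τ ((neg-t f ⊛ g) n)                   ≈⟨ ⟦⟧-cong (fg n) ⟩
          τ (oneₚ n)                            ≈⟨ mapₚ-oneₚ ring-hom n ⟩
          oneₚ n                                ∎

      τ∘g′≈f[-t]′ : mapₚ τ (deriv g) ≈ₚ deriv (neg-t f)
      τ∘g′≈f[-t]′ n = trans (mapₚ-deriv ring-hom g n) (deriv-cong τ∘g≈f[-t] n)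

      τ-λ : ∀ n → τ (f n) ≈ sign n * g n
      τ-λ n = begin
        τ (f n)                         ≈⟨ sign-involutive n _ ⟨
        sign n * (sign n * τ (f n))     ≈⟨ *-congˡ (*-congʳ (homo-sign ring-hom n)) ⟨
        sign n * (τ (sign n) * τ (f n)) ≈⟨ *-congˡ (*-homo _ _) ⟨
        sign n * τ (neg-t f n)          ≈⟨ *-congˡ (τ∘f[-t]≈g n) ⟩
        sign n * g n                    ∎

      τ-s : ∀ n → τ (g n) ≈ sign n * f n
      τ-s = τ∘g≈f[-t]

      τ-h : ∀ n → τ (h n) ≈ - m n
      τ-h n = begin
        τ (h n)                                     ≈⟨ ⟦⟧-cong (h≈f[-t]⊛g′ n) ⟩
        τ ((neg-t f ⊛ deriv g) n)                   ≈⟨ mapₚ-⊛ ring-hom (neg-t f) (deriv g) n ⟩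
        (mapₚ τ (neg-t f) ⊛ mapₚ τ (deriv g)) n     ≈⟨ ⊛-cong τ∘f[-t]≈g τ∘g′≈f[-t]′ n ⟩
        (g ⊛ deriv (neg-t f)) n                     ≈⟨ +-inverseʳ-unique _ _ (deriv-⊛-inverse {g} {neg-t f} gf n) ⟩
        - (deriv g ⊛ neg-t f) n                     ≈⟨ -‿cong (m≈g′⊛f[-t] n) ⟨
        - m n                                       ∎

      τ-m : ∀ n → τ (m n) ≈ - h n
      τ-m n = begin
        τ (m n)                                     ≈⟨ ⟦⟧-cong (m≈g′⊛f[-t] n) ⟩
        τ ((deriv g ⊛ neg-t f) n)                   ≈⟨ mapₚ-⊛ ring-hom (deriv g) (neg-t f) n ⟩
        (mapₚ τ (deriv g) ⊛ mapₚ τ (neg-t f)) n     ≈⟨ ⊛-cong τ∘g′≈f[-t]′ τ∘f[-t]≈g n ⟩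
        (deriv (neg-t f) ⊛ g) n                     ≈⟨ +-inverseˡ-unique _ _ (deriv-⊛-inverse {neg-t f} {g} fg n) ⟩
        - (neg-t f ⊛ deriv g) n                     ≈⟨ -‿cong (h≈f[-t]⊛g′ n) ⟨
        - h n                                       ∎

-- The identities hold for every n.
proposition2p10 : {c₁ ℓ₁ c ℓ : Level} (K : QAlgebra c₁ ℓ₁) (A : KAlgebra K c ℓ)
    → let open KAlgebra A in
      let open PowerSeries A in
      (f g d h m : PS) → IsNCS f g d h m
    → (τ : Carrier → Carrier) → IsKAlgebraEndo A τ
    → (∀ n → 1 ≤ n → τ (φ-coeff d n) ≈ - φ-coeff d n)
    → ∀ n → 1 ≤ n
    → (τ (λ-coeff f n) ≈ sign n * s-coeff g n)
      × (τ (s-coeff g n) ≈ sign n * λ-coeff f n)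
      × (τ (ψ-coeff h n) ≈ - ξ-coeff m n)
      × (τ (ξ-coeff m n) ≈ - ψ-coeff h n)
proposition2p10 K A f g d h m ncs τ endo τφ≈-φ n _ =
  τ-λ n , τ-s n , τ-h (n ∸ 1) , τ-m (n ∸ 1)
  where open NCS.Reflection A ncs endo τφ≈-φ
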